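{- The midpoint operation $\oplus:\mathbb I\times\mathbb I\to\mathbb I$ is continuous.
   Context: $\mathbb I=\mathbb N\to\{ -1,0,1\}$ is the type of ternary (signed-digit) sequences, a sequence $r$ encoding the real number $\sum_{i\in\mathbb N}r(i)\,2^{ -(i+1)}\in[-1,1]$. For a digit $x$ and a sequence $x'$, $x+\!\!+\,x'$ denotes the sequence with head $x$ and tail $x'$. Digits are regarded as integers, $+$ is integer addition and $2i=i+i$. Define $\lceil\cdot\rceil:\mathbb Z\to\{ -1,0,1\}$ by $\lceil m\rceil=-1$ if $m\le-2$, $0$ if $-2<m\le1$, $1$ if $1<m$; and $\lfloor\cdot\rfloor:\mathbb Z\to\mathbb Z$ by $\lfloor m\rfloor=m+4$ if $m\le-2$, $m$ if $-2<m\le1$, $m-4$ if $1<m$. Define $\boxplus:\mathbb I\times\mathbb I\times\mathbb Z\to\mathbb I$ by $\boxplus(x+\!\!+\,x',y+\!\!+\,y',i)_0=\lceil 2i+x+y\rceil$ and $\boxplus(x+\!\!+\,x',y+\!\!+\,y',i)_{m+1}=\boxplus(x',y',\lfloor 2i+x+y\rfloor)_m$. The midpoint is $(x+\!\!+\,x')\oplus(y+\!\!+\,y')=\boxplus(x',y',x+y)$. Continuity: $\mathbb I$ and $\mathbb I\times\mathbb I$ have exactness types $E(\mathbb I)=\mathbb N\times\mathbf 1$ and $E(\mathbb I\times\mathbb I)=E(\mathbb I)\times E(\mathbb I)$; for $\alpha,\beta\in\mathbb I$, $\alpha\equiv_{(m,*)}\beta$ iff $\alpha(i)=\beta(i)$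 for all $i<m$, and equality with precision on pairs is componentwise. A function $f:T\to T'$ is continuous if for every precision $p$ of $T'$ there is a precision $q$ of $T$ such that $x\equiv_q x'$ implies $f(x)\equiv_p f(x')$. -}

module Defs where

open import Data.Nat using (ℕ; zero; suc)
open import Data.Nat as N using ()
open import Data.Integer using (ℤ; +_; -[1+_]; _+_; _-_; _≤?_; _<?_)
open import Data.Unit using (⊤; tt)
open import Data.Product using (_×_; _,_; Σ; proj₁; proj₂)
open import Relation.Binary.PropositionalEquality using (_≡_)
open import Relation.Nullary.Decidable using (does)
open import Data.Bool using (if_then_else_)

data Digit : Set where
  d-1 d0 d1 : Digit

⟦_⟧ : Digit → ℤ
⟦ d-1 ⟧ = -[1+ 0 ]
⟦ d0 ⟧ = + 0
⟦ d1 ⟧ = + 1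

𝕀 : Set
𝕀 = ℕ → Digit

hd : 𝕀 → Digit
hd α = α 0

tl : 𝕀 → 𝕀
tl α n = α (suc n)

⌈_⌉ : ℤ → Digit
⌈ m ⌉ = if does (m ≤? -[1+ 1 ]) then d-1 else (if does (m ≤? + 1) then d0 else d1)

⌊_⌋ : ℤ → ℤ
⌊ m ⌋ = if does (m ≤? -[1+ 1 ]) then m + + 4 else (if does (m ≤? + 1) then m else m - + 4)

⊞ : 𝕀 → 𝕀 → ℤ → 𝕀
⊞ α β i zero = ⌈ (i + i) + ⟦ hd α ⟧ + ⟦ hd β ⟧ ⌉
⊞ α β i (suc m) = ⊞ (tl α) (tl β) ⌊ (i + i) + ⟦ hd α ⟧ + ⟦ hd β ⟧ ⌋ m

_⊕_ : 𝕀 → 𝕀 → 𝕀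
α ⊕ β = ⊞ (tl α) (tl β) (⟦ hd α ⟧ + ⟦ hd β ⟧)

record Exact (T : Set) : Set₁ where
  field
    E : Set
    _≡[_]_ : T → E → T → Set
open Exact

𝕀-Exact : Exact 𝕀
E 𝕀-Exact = ℕ × ⊤
_≡[_]_ 𝕀-Exact α (m , _) β = (i : ℕ) → i N.< m → α i ≡ β i

×-Exact : {A B : Set} → Exact A → Exact B → Exact (A × B)
E (×-Exact EA EB) = E EA × E EB
_≡[_]_ (×-Exact EA EB) (a , b) (p , q) (a' , b') =
  _≡[_]_ EA a p a' × _≡[_]_ EB b q b'

continuous : {T T' : Set} → Exact T → Exact T' → (T → T') → Set
continuous ET ET' f =
  (p : E ET') → Σ (E ET) λ q →
    ∀ x x' → _≡[_]_ ET x q x' → _≡[_]_ ET' (f x) p (f x')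

midpoint : 𝕀 × 𝕀 → 𝕀
midpoint (α , β) = α ⊕ β

module Submission where

open import Defs
open import Data.Nat using (ℕ; zero; suc; _<_; s≤s; z≤n)
open import Data.Integer using (ℤ)
open import Data.Product using (_,_)
open import Data.Unit using (tt)
open import Relation.Binary.PropositionalEquality using (_≡_; refl)

_≈⟨_⟩_ : 𝕀 → ℕ → 𝕀 → Set
α ≈⟨ n ⟩ β = Exact._≡[_]_ 𝕀-Exact α (n , tt) β

hd-cong : ∀ {n α β} → α ≈⟨ suc n ⟩ β → hd α ≡ hd β
hd-cong α≈β = α≈β 0 (s≤s z≤n)

tl-cong : ∀ {n α β} → α ≈⟨ suc n ⟩ β → tl α ≈⟨ n ⟩ tl β
tl-cong α≈β k k<n = α≈β (suc k) (s≤s k<n)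

⊞-cong : ∀ {n α α' β β'} (i : ℤ) → α ≈⟨ n ⟩ α' → β ≈⟨ n ⟩ β' →
         ⊞ α β i ≈⟨ n ⟩ ⊞ α' β' i
⊞-cong {suc n} i α≈ β≈ zero _
  rewrite hd-cong α≈ | hd-cong β≈ = refl
⊞-cong {suc n} i α≈ β≈ (suc k) (s≤s k<n)
  rewrite hd-cong α≈ | hd-cong β≈ = ⊞-cong _ (tl-cong α≈) (tl-cong β≈) k k<n

-- ⊕ consumes the two head digits before ⊞ starts, hence the loss of one digit of precision.
⊕-cong : ∀ {n α α' β β'} → α ≈⟨ suc n ⟩ α' → β ≈⟨ suc n ⟩ β' →
         (α ⊕ β) ≈⟨ n ⟩ (α' ⊕ β')
⊕-cong α≈ β≈ rewrite hd-cong α≈ | hd-cong β≈ = ⊞-cong _ (tl-cong α≈) (tl-cong β≈)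

mainTheorem14 : continuous (×-Exact 𝕀-Exact 𝕀-Exact) 𝕀-Exact midpoint
mainTheorem14 (n , _) =
  ((suc n , tt) , (suc n , tt)) , λ { (α , β) (α' , β') (α≈ , β≈) → ⊕-cong α≈ β≈ }
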